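{- Let $R$ be a finite commutative local ring with unity and $x$ a nonzero element of $R$. Let $R^*$ be the units of $R$, $xR^*=\{xr : r \in R^*\}$, $I_x$ the ideal generated by $x$, and $M_x = I_x\setminus xR^*$. Then the adjacency spectrum of $\mathrm{Cay}(R, xR^*)$ is: eigenvalue $|xR^*|$ with multiplicity $\frac{|R|}{|I_x|}$, eigenvalue $-|M_x|$ with multiplicity $\frac{|R|\,|xR^*|}{|I_x|\,|M_x|}$, and eigenvalue $0$ with multiplicity $\frac{|R|}{|M_x|}(|M_x| - 1)$.
   Context: $\mathrm{Cay}(R, xR^*)$ is the graph with vertex set $R$ in which $u,v$ are adjacent iff $u - v \in xR^*$. Eigenvalues of a graph are those of its $(0,1)$-adjacency matrix. -}

module Defs where

open import Level using (0ℓ)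
open import Data.Nat using (ℕ; zero; suc)
open import Data.Fin using (Fin)
import Data.Fin.Properties as FinP
open import Data.List using (length; filter)
open import Data.List.Base using (allFin)
open import Data.Product using (Σ; ∃; _×_; _,_)
open import Data.Sum using (_⊎_)
open import Data.Bool using (true; false)
open import Relation.Nullary using (¬_; Dec; yes; no; _×-dec_)
open import Relation.Unary using (Pred; Decidable)
open import Relation.Binary.PropositionalEquality using (_≡_; _≢_)
open import Algebra.Core using (Op₁; Op₂)
open import Algebra.Structures using (IsCommutativeRing)
open import Data.Rational as ℚ using (ℚ; 0ℚ; 1ℚ)
import Data.Integer as ℤ

-- A finite commutative ring with unity.  Every finite ring is isomorphic
-- to one whose carrier is Fin n (n = |R|), with propositional equality.
record FinCommRing (n : ℕ) : Set where
  infixl 6 _+_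
  infixl 7 _*_
  field
    _+_ _*_ : Op₂ (Fin n)
    -_      : Op₁ (Fin n)
    0# 1#   : Fin n
    isCommutativeRing : IsCommutativeRing _≡_ _+_ _*_ -_ 0# 1#

  _-_ : Op₂ (Fin n)
  a - b = a + (- b)

  IsUnit : Pred (Fin n) 0ℓ
  IsUnit r = ∃ λ s → r * s ≡ 1#

  isUnit? : Decidable IsUnit
  isUnit? r = FinP.any? (λ s → r * s FinP.≟ 1#)

  -- local ring (Mathlib's definition): nontrivial, and if a + b is a unit
  -- then a or b is a unit (equivalently: a unique maximal ideal).
  IsLocal : Set
  IsLocal = (0# ≢ 1#) × (∀ a b → IsUnit (a + b) → IsUnit a ⊎ IsUnit b)

  InxR* : Fin n → Pred (Fin n) 0ℓ
  InxR* x y = ∃ λ r → IsUnit r × y ≡ x * r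

  inxR*? : (x : Fin n) → Decidable (InxR* x)
  inxR*? x y = FinP.any? (λ r → isUnit? r ×-dec (y FinP.≟ x * r))

  -- I_x = ideal generated by x = { x r : r ∈ R }  (R commutative with 1)
  InI : Fin n → Pred (Fin n) 0ℓ
  InI x y = ∃ λ r → y ≡ x * r

  inI? : (x : Fin n) → Decidable (InI x)
  inI? x y = FinP.any? (λ r → y FinP.≟ x * r)

  InM : Fin n → Pred (Fin n) 0ℓ
  InM x y = InI x y × ¬ InxR* x y

  inM? : (x : Fin n) → Decidable (InM x)
  inM? x y with inI? x y | inxR*? x y
  ... | yes p | no q  = yes (p , q)
  ... | yes _ | yes q = no (λ { (_ , nq) → nq q })
  ... | no p  | _     = no (λ { (q , _) → p q })

count : ∀ {n} {P : Pred (Fin n) 0ℓ} → Decidable P → ℕ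
count {n} P? = length (filter P? (allFin n))

Σℚ : ∀ k → (Fin k → ℚ) → ℚ
Σℚ zero    f = 0ℚ
Σℚ (suc k) f = f Fin.zero ℚ.+ Σℚ k (λ i → f (Fin.suc i))
  where import Data.Fin as Fin

Matrix : ℕ → Set
Matrix n = Fin n → Fin n → ℚ

Vector : ℕ → Set
Vector n = Fin n → ℚ

cayleyAdj : ∀ {n} → FinCommRing n → Fin n → Matrix n
cayleyAdj R x u v with FinCommRing.inxR*? R x (FinCommRing._-_ R u v)
... | yes _ = 1ℚ
... | no _  = 0ℚ

InEigenspace : ∀ {n} → Matrix n → ℚ → Vector n → Set
InEigenspace {n} A λ′ v = ∀ i → Σℚ n (λ j → A i j ℚ.* v j) ≡ λ′ ℚ.* v i

LinIndep : ∀ {n k} → (Fin k → Vector n) → Set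
LinIndep {n} {k} vs =
  ∀ (c : Fin k → ℚ) → (∀ i → Σℚ k (λ j → c j ℚ.* vs j i) ≡ 0ℚ) → ∀ j → c j ≡ 0ℚ

-- λ is an eigenvalue of A with multiplicity m (m = dimension of the
-- λ-eigenspace; m = 0 means λ is not an eigenvalue).  For the symmetric
-- adjacency matrix, geometric and algebraic multiplicities coincide.
HasEigMult : ∀ {n} → Matrix n → ℚ → ℕ → Set
HasEigMult {n} A λ′ m =
  (Σ (Fin m → Vector n) λ vs → (∀ j → InEigenspace A λ′ (vs j)) × LinIndep vs)
  × (∀ (vs : Fin (suc m) → Vector n) → (∀ j → InEigenspace A λ′ (vs j)) → ¬ LinIndep vs)

ℕ→ℚ : ℕ → ℚ
ℕ→ℚ k = (ℤ.+ k) ℚ./ 1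

{-# OPTIONS --safe #-}
-- Write I = xR and M = I ∖ xR*. In a local ring with x ≢ 0, M = x·(non-units), so I and M
-- are additive subgroups with M ⊆ I, and xR* = I ∖ M is a union of M-cosets inside I. Hence
-- Cay(R, xR*) is the Cayley graph of (R, +) with connection set I ∖ M, and its adjacency
-- operator A acts on simple vectors as follows:
--   A 1_{a+I} = |xR*| 1_{a+I},   A 1_{a+M} = |M| 1_{a+xR*},   A δ_a = 1_{a+xR*}.
-- So indicators of the |R|/|I| cosets of I are eigenvectors for |xR*|; differences 1_{a+M} − 1_{b+M}
-- of M-cosets inside one I-coset (|R|/|M| − |R|/|I| of them) are eigenvectors for −|M|; and
-- differences δ_a − δ_b inside one M-coset (|R| − |R|/|M| of them) lie in the kernel. Taking the least
-- element of each coset as its representative, each family has an evident pivot and is independent.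
-- The three eigenvalues are distinct and the family sizes add up to |R|, so a dimension count shows
-- that each family spans its whole eigenspace.
module Submission where

open import Defs
open import Level using (0ℓ)
open import Algebra.Bundles using (CommutativeSemiring)
open import Data.Fin.Base using (Fin)
open import Data.Product using (∃; _×_; _,_; proj₁; proj₂)
open import Function.Bundles using (_⇔_; Equivalence)
open import Relation.Nullary using (¬_; does)
open import Relation.Unary using (Pred; Decidable)
open import Relation.Binary.PropositionalEquality using (_≡_; _≢_)

module FinSums (S : CommutativeSemiring 0ℓ 0ℓ) where

  open CommutativeSemiring S
  open import Data.Nat.Base using (suc)
  open import Data.Fin.Base using (Fin; punchIn)
  open import Data.Fin.Properties using (punchInᵢ≢i)
  import Data.Fin.Permutation as Permutation
  open import Relation.Binary.PropositionalEquality using (_≡_; _≢_)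
  open import Algebra.Properties.Semiring.Sum semiring public

  sum-zero : ∀ {n} (f : Fin n → Carrier) → (∀ i → f i ≈ 0#) → sum f ≈ 0#
  sum-zero {n} f f≈0 = trans (sum-cong-≋ f≈0) (sum-replicate-zero n)

  sum-δ : ∀ {n} (f : Fin n → Carrier) k → (∀ j → j ≢ k → f j ≈ 0#) → sum f ≈ f k
  sum-δ {suc n} f k off = trans (sum-remove {i = k} f)
    (trans (+-congˡ (sum-zero _ (λ j → off (punchIn k j) (punchInᵢ≢i k j)))) (+-identityʳ _))

  sum-involution : ∀ {n} (f : Fin n → Carrier) (σ : Fin n → Fin n) → (∀ i → σ (σ i) ≡ i) →
    sum f ≈ sum (λ i → f (σ i))
  sum-involution f σ σσ≡id = ∑-permute f (Permutation.permutation σ σ σσ≡id σσ≡id)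

module BooleanPredicates where

  open import Level using (0ℓ)
  open import Data.Bool.Base using (Bool; true; false; not; _∧_)
  open import Data.Nat.Base using (ℕ; zero; suc; _+_)
  import Data.Nat.Properties as ℕ
  open import Data.Fin.Base using (Fin; zero; suc)
  import Data.Fin.Properties as Fin
  open import Data.List.Base using (length; filter; tabulate)
  open import Data.Product using (∃; _×_; _,_)
  open import Data.Maybe.Base as Maybe using (Maybe; just; nothing)
  open import Relation.Nullary using (Dec; yes; no; does)
  open import Relation.Nullary.Decidable using (dec-true; dec-false)
  open import Relation.Unary using (Pred; Decidable)
  open import Relation.Binary.PropositionalEquality
  open FinSums ℕ.+-*-commutativeSemiring using (sum; sum-cong-≗; ∑-distrib-+)

  ind : Bool → ℕ
  ind true  = 1
  ind false = 0

  countᵇ : ∀ {n} → (Fin n → Bool) → ℕ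
  countᵇ p = sum (λ i → ind (p i))

  length-filter-tabulate : ∀ {n m} {P : Pred (Fin m) 0ℓ} (P? : Decidable P) (f : Fin n → Fin m) →
    length (filter P? (tabulate f)) ≡ countᵇ (λ i → does (P? (f i)))
  length-filter-tabulate {zero}  P? f = refl
  length-filter-tabulate {suc n} P? f with does (P? (f zero))
  ... | true  = cong suc (length-filter-tabulate P? (λ i → f (suc i)))
  ... | false = length-filter-tabulate P? (λ i → f (suc i))

  count≡countᵇ : ∀ {n} {P : Pred (Fin n) 0ℓ} (P? : Decidable P) → count P? ≡ countᵇ (λ i → does (P? i))
  count≡countᵇ P? = length-filter-tabulate P? (λ i → i)

  countᵇ-+ : ∀ {n} (p q r : Fin n → Bool) → (∀ i → ind (p i) + ind (q i) ≡ ind (r i)) →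
    countᵇ p + countᵇ q ≡ countᵇ r
  countᵇ-+ p q r e = trans (sym (∑-distrib-+ (λ i → ind (p i)) (λ i → ind (q i)))) (sum-cong-≗ e)

  countᵇ-true : ∀ n → countᵇ {n} (λ _ → true) ≡ n
  countᵇ-true zero    = refl
  countᵇ-true (suc n) = cong suc (countᵇ-true n)

  countᵇ-nonEmpty : ∀ {n} (p : Fin n → Bool) i → p i ≡ true → ∃ λ k → countᵇ p ≡ suc k
  countᵇ-nonEmpty p zero    pᵢ rewrite pᵢ = countᵇ (λ i → p (suc i)) , refl
  countᵇ-nonEmpty p (suc i) pᵢ with p zero | countᵇ-nonEmpty (λ i → p (suc i)) i pᵢ
  ... | true  | _ = countᵇ (λ i → p (suc i)) , refl
  ... | false | k = k

  ind-∧-not : ∀ b c → (c ≡ true → b ≡ true) → ind (b ∧ not c) + ind c ≡ ind b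
  ind-∧-not true  true  _ = refl
  ind-∧-not true  false _ = refl
  ind-∧-not false true  c⇒b with () ← c⇒b refl
  ind-∧-not false false _ = refl

  true≢false : true ≢ false
  true≢false ()

  ∧-not-true : ∀ b c → b ∧ not c ≡ true → b ≡ true × c ≡ false
  ∧-not-true true false _ = refl , refl

  not-true : ∀ b → not b ≡ true → b ≡ false
  not-true false _ = refl

  does-true : ∀ {A : Set} (a? : Dec A) → does a? ≡ true → A
  does-true (yes a) _ = a

  does-⇔ : ∀ {A B : Set} (a? : Dec A) (b? : Dec B) → (A → B) → (B → A) → does a? ≡ does b?
  does-⇔ (yes a) b? to from = sym (dec-true b? (to a))
  does-⇔ (no ¬a) b? to from = sym (dec-false b? (λ b → ¬a (from b)))

  firstᵇ : ∀ {n} → (Fin n → Bool) → Maybe (Fin n)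
  firstᵇ {zero}  p = nothing
  firstᵇ {suc n} p with p zero
  ... | true  = just zero
  ... | false = Maybe.map suc (firstᵇ (λ i → p (suc i)))

  firstᵇ-true : ∀ {n} (p : Fin n → Bool) {i} → firstᵇ p ≡ just i → p i ≡ true
  firstᵇ-true {suc n} p eq with p zero in p₀
  firstᵇ-true {suc n} p refl | true = p₀
  firstᵇ-true {suc n} p eq   | false with firstᵇ (λ i → p (suc i)) in eq′
  firstᵇ-true {suc n} p refl | false | just _ = firstᵇ-true (λ i → p (suc i)) eq′

  firstᵇ-nothing : ∀ {n} (p : Fin n → Bool) {i} → firstᵇ p ≡ nothing → p i ≢ true
  firstᵇ-nothing {suc n} p eq pᵢ with p zero in p₀
  firstᵇ-nothing {suc n} p () pᵢ | true
  firstᵇ-nothing {suc n} p eq pᵢ | false with firstᵇ (λ i → p (suc i)) in eq′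
  firstᵇ-nothing {suc n} p {zero}  eq pᵢ | false | nothing with () ← trans (sym p₀) pᵢ
  firstᵇ-nothing {suc n} p {suc i} eq pᵢ | false | nothing = firstᵇ-nothing (λ i → p (suc i)) eq′ pᵢ

  firstᵇ-cong : ∀ {n} {p q : Fin n → Bool} → (∀ i → p i ≡ q i) → firstᵇ p ≡ firstᵇ q
  firstᵇ-cong {zero}  p≗q = refl
  firstᵇ-cong {suc n} {p} {q} p≗q with p zero | q zero | p≗q zero
  ... | true  | true  | _ = refl
  ... | false | false | _ = cong (Maybe.map suc) (firstᵇ-cong (λ i → p≗q (suc i)))

  firstᵇ-⊆ : ∀ {n} {p q : Fin n → Bool} → (∀ i → p i ≡ true → q i ≡ true) →
    ∀ {i} → firstᵇ q ≡ just i → p i ≡ true → firstᵇ p ≡ just i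
  firstᵇ-⊆ {suc n} {p} {q} p⊆q eq pᵢ with q zero in q₀ | p zero in p₀
  firstᵇ-⊆ {suc n} p⊆q refl pᵢ | true  | true  = refl
  firstᵇ-⊆ {suc n} p⊆q refl pᵢ | true  | false with () ← trans (sym p₀) pᵢ
  firstᵇ-⊆ {suc n} p⊆q eq   pᵢ | false | true  with () ← trans (sym q₀) (p⊆q zero p₀)
  firstᵇ-⊆ {suc n} {p} {q} p⊆q eq pᵢ | false | false with firstᵇ (λ i → q (suc i)) in eq′
  firstᵇ-⊆ {suc n} {p} {q} p⊆q refl pᵢ | false | false | just _ =
    cong (Maybe.map suc) (firstᵇ-⊆ (λ i → p⊆q (suc i)) eq′ pᵢ)

  enumᵇ : ∀ {n} (p : Fin n → Bool) → Fin (countᵇ p) → Fin n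
  enumᵇ {suc n} p j with p zero
  enumᵇ {suc n} p zero    | true  = zero
  enumᵇ {suc n} p (suc j) | true  = suc (enumᵇ (λ i → p (suc i)) j)
  enumᵇ {suc n} p j       | false = suc (enumᵇ (λ i → p (suc i)) j)

  enumᵇ-true : ∀ {n} (p : Fin n → Bool) j → p (enumᵇ p j) ≡ true
  enumᵇ-true {suc n} p j with p zero in p₀
  enumᵇ-true {suc n} p zero    | true  = p₀
  enumᵇ-true {suc n} p (suc j) | true  = enumᵇ-true (λ i → p (suc i)) j
  enumᵇ-true {suc n} p j       | false = enumᵇ-true (λ i → p (suc i)) j

  enumᵇ-injective : ∀ {n} (p : Fin n → Bool) i j → enumᵇ p i ≡ enumᵇ p j → i ≡ j
  enumᵇ-injective {suc n} p i j e with p zero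
  enumᵇ-injective {suc n} p zero    zero    e  | true = refl
  enumᵇ-injective {suc n} p (suc i) (suc j) e  | true =
    cong suc (enumᵇ-injective (λ i → p (suc i)) i j (Fin.suc-injective e))
  enumᵇ-injective {suc n} p i j e | false =
    enumᵇ-injective (λ i → p (suc i)) i j (Fin.suc-injective e)

module ℕ→ℚ-Properties where

  open import Data.Nat.Base using (zero; suc)
  import Data.Nat.Coprimality as Coprime
  open import Data.Integer.Base as ℤ using (+_)
  import Data.Integer.Properties as ℤ
  open import Data.Rational.Base using (mkℚ; 1ℚ; 0ℚ; _+_; -_; _/_; ↥_)
  open import Data.Rational.Properties using (↥p/↧p≡p; ↥-neg; neg-injective)
  open import Relation.Binary.PropositionalEquality

  ℕ→ℚ≡mkℚ : ∀ a → ℕ→ℚ a ≡ mkℚ (+ a) 0 (Coprime.sym (Coprime.1-coprimeTo a))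
  ℕ→ℚ≡mkℚ a = ↥p/↧p≡p (mkℚ (+ a) 0 (Coprime.sym (Coprime.1-coprimeTo a)))

  ↥ℕ→ℚ : ∀ a → ↥ (ℕ→ℚ a) ≡ + a
  ↥ℕ→ℚ a = cong ↥_ (ℕ→ℚ≡mkℚ a)

  ↥-neg-ℕ→ℚ : ∀ a → ↥ (- ℕ→ℚ a) ≡ ℤ.- (+ a)
  ↥-neg-ℕ→ℚ a = trans (↥-neg (ℕ→ℚ a)) (cong ℤ.-_ (↥ℕ→ℚ a))

  ℕ→ℚ-suc : ∀ a → ℕ→ℚ (suc a) ≡ 1ℚ + ℕ→ℚ a
  ℕ→ℚ-suc a = sym (begin
    1ℚ + ℕ→ℚ a                    ≡⟨ cong (λ t → 1ℚ + t) (ℕ→ℚ≡mkℚ a) ⟩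
    (+ 1 ℤ.+ + a ℤ.* + 1) / 1     ≡⟨ cong (λ t → (+ 1 ℤ.+ t) / 1) (ℤ.*-identityʳ (+ a)) ⟩
    ℕ→ℚ (suc a)                   ∎)
    where open ≡-Reasoning

  ℕ→ℚ-suc≢0 : ∀ a → ℕ→ℚ (suc a) ≢ 0ℚ
  ℕ→ℚ-suc≢0 a e with trans (sym (↥ℕ→ℚ (suc a))) (cong ↥_ e)
  ... | ()

  -ℕ→ℚ-suc≢0 : ∀ a → - ℕ→ℚ (suc a) ≢ 0ℚ
  -ℕ→ℚ-suc≢0 a e = ℕ→ℚ-suc≢0 a (neg-injective e)

  ℕ→ℚ-suc≢-ℕ→ℚ : ∀ a b → ℕ→ℚ (suc a) ≢ - ℕ→ℚ b
  ℕ→ℚ-suc≢-ℕ→ℚ a zero    e = ℕ→ℚ-suc≢0 a e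
  ℕ→ℚ-suc≢-ℕ→ℚ a (suc b) e with trans (sym (↥ℕ→ℚ (suc a))) (trans (cong ↥_ e) (↥-neg-ℕ→ℚ (suc b)))
  ... | ()

module Σℚ-Properties where

  open import Data.Bool.Base using (Bool; true; false; not; _∧_)
  open import Data.Nat.Base as ℕ using (ℕ; zero; suc)
  open import Data.Fin.Base using (Fin; zero; suc; punchIn; _↑ˡ_; _↑ʳ_)
  open import Data.Rational.Base using (ℚ; 0ℚ; 1ℚ; _+_; _*_; -_; _-_)
  import Data.Rational.Properties as ℚ
  open import Relation.Binary.PropositionalEquality
  open import Algebra.Bundles using (CommutativeRing)
  open BooleanPredicates using (countᵇ)
  open ℕ→ℚ-Properties using (ℕ→ℚ-suc)

  private
    module Σ = FinSums (CommutativeRing.commutativeSemiring ℚ.+-*-commutativeRing)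

  Σℚ≡sum : ∀ k (f : Fin k → ℚ) → Σℚ k f ≡ Σ.sum f
  Σℚ≡sum zero    f = refl
  Σℚ≡sum (suc k) f = cong (f zero +_) (Σℚ≡sum k (λ i → f (suc i)))

  Σℚ-cong : ∀ {n} {f g : Fin n → ℚ} → (∀ i → f i ≡ g i) → Σℚ n f ≡ Σℚ n g
  Σℚ-cong {n} {f} {g} f≗g = trans (Σℚ≡sum n f) (trans (Σ.sum-cong-≗ f≗g) (sym (Σℚ≡sum n g)))

  Σℚ-zero : ∀ {n} (f : Fin n → ℚ) → (∀ i → f i ≡ 0ℚ) → Σℚ n f ≡ 0ℚ
  Σℚ-zero {n} f f≗0 = trans (Σℚ≡sum n f) (Σ.sum-zero f f≗0)

  Σℚ-δ : ∀ {n} (f : Fin n → ℚ) k → (∀ j → j ≢ k → f j ≡ 0ℚ) → Σℚ n f ≡ f k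
  Σℚ-δ {n} f k off = trans (Σℚ≡sum n f) (Σ.sum-δ f k off)

  Σℚ-+ : ∀ {n} (f g : Fin n → ℚ) → Σℚ n (λ i → f i + g i) ≡ Σℚ n f + Σℚ n g
  Σℚ-+ {n} f g = trans (Σℚ≡sum n _)
    (trans (Σ.∑-distrib-+ f g) (sym (cong₂ _+_ (Σℚ≡sum n f) (Σℚ≡sum n g))))

  Σℚ-*ˡ : ∀ {n} c (f : Fin n → ℚ) → Σℚ n (λ i → c * f i) ≡ c * Σℚ n f
  Σℚ-*ˡ {n} c f = trans (Σℚ≡sum n _)
    (trans (sym (Σ.*-distribˡ-sum c f)) (sym (cong (c *_) (Σℚ≡sum n f))))

  Σℚ-*ʳ : ∀ {n} c (f : Fin n → ℚ) → Σℚ n (λ i → f i * c) ≡ Σℚ n f * c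
  Σℚ-*ʳ {n} c f = trans (Σℚ≡sum n _)
    (trans (sym (Σ.*-distribʳ-sum c f)) (sym (cong (_* c) (Σℚ≡sum n f))))

  Σℚ-neg : ∀ {n} (f : Fin n → ℚ) → Σℚ n (λ i → - f i) ≡ - Σℚ n f
  Σℚ-neg {zero}  f = refl
  Σℚ-neg {suc n} f = trans (cong (- f zero +_) (Σℚ-neg (λ i → f (suc i))))
                           (sym (ℚ.neg-distrib-+ (f zero) (Σℚ n (λ i → f (suc i)))))

  Σℚ-sub : ∀ {n} (f g : Fin n → ℚ) → Σℚ n (λ i → f i - g i) ≡ Σℚ n f - Σℚ n g
  Σℚ-sub {n} f g = trans (Σℚ-+ f (λ i → - g i)) (cong (Σℚ n f +_) (Σℚ-neg g))

  Σℚ-comm : ∀ {m n} (f : Fin m → Fin n → ℚ) →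
    Σℚ m (λ i → Σℚ n (f i)) ≡ Σℚ n (λ j → Σℚ m (λ i → f i j))
  Σℚ-comm {m} {n} f = begin
    Σℚ m (λ i → Σℚ n (f i))
      ≡⟨ trans (Σℚ-cong (λ i → Σℚ≡sum n (f i))) (Σℚ≡sum m _) ⟩
    Σ.sum (λ i → Σ.sum (f i))
      ≡⟨ Σ.∑-comm f ⟩
    Σ.sum (λ j → Σ.sum (λ i → f i j))
      ≡⟨ sym (trans (Σℚ-cong (λ j → Σℚ≡sum m (λ i → f i j))) (Σℚ≡sum n _)) ⟩
    Σℚ n (λ j → Σℚ m (λ i → f i j)) ∎
    where open ≡-Reasoning

  Σℚ-↑ : ∀ m n (f : Fin (m ℕ.+ n) → ℚ) →
    Σℚ (m ℕ.+ n) f ≡ Σℚ m (λ i → f (i ↑ˡ n)) + Σℚ n (λ i → f (m ↑ʳ i))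
  Σℚ-↑ zero    n f = sym (ℚ.+-identityˡ _)
  Σℚ-↑ (suc m) n f = trans (cong (f zero +_) (Σℚ-↑ m n (λ i → f (suc i))))
                           (sym (ℚ.+-assoc (f zero) _ _))

  Σℚ-punchIn : ∀ {k} (f : Fin (suc k) → ℚ) j → Σℚ (suc k) f ≡ f j + Σℚ k (λ i → f (punchIn j i))
  Σℚ-punchIn {k} f j = trans (Σℚ≡sum (suc k) f)
    (trans (Σ.sum-remove {i = j} f) (cong (f j +_) (sym (Σℚ≡sum k _))))

  Σℚ-involution : ∀ {n} (f : Fin n → ℚ) (σ : Fin n → Fin n) → (∀ i → σ (σ i) ≡ i) →
    Σℚ n f ≡ Σℚ n (λ i → f (σ i))
  Σℚ-involution {n} f σ σσ≡id =
    trans (Σℚ≡sum n f) (trans (Σ.sum-involution f σ σσ≡id) (sym (Σℚ≡sum n _)))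

  indℚ : Bool → ℚ
  indℚ true  = 1ℚ
  indℚ false = 0ℚ

  indℚ-∧-not : ∀ b c → (c ≡ true → b ≡ true) → indℚ (b ∧ not c) ≡ indℚ b - indℚ c
  indℚ-∧-not true  true  _ = refl
  indℚ-∧-not true  false _ = refl
  indℚ-∧-not false true  c⇒b with () ← c⇒b refl
  indℚ-∧-not false false _ = refl

  indℚ-*-congʳ : ∀ a b c → (a ≡ true → b ≡ c) → indℚ a * indℚ b ≡ indℚ a * indℚ c
  indℚ-*-congʳ true  b c b≡c = cong (λ d → 1ℚ * indℚ d) (b≡c refl)
  indℚ-*-congʳ false b c _   = trans (ℚ.*-zeroˡ (indℚ b)) (sym (ℚ.*-zeroˡ (indℚ c)))

  indℚ-*-congˡ : ∀ a b c → (c ≡ true → a ≡ b) → indℚ a * indℚ c ≡ indℚ b * indℚ c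
  indℚ-*-congˡ a b true  a≡b = cong (λ d → indℚ d * 1ℚ) (a≡b refl)
  indℚ-*-congˡ a b false _   = trans (ℚ.*-zeroʳ (indℚ a)) (sym (ℚ.*-zeroʳ (indℚ b)))

  Σℚ-indℚ : ∀ {n} (p : Fin n → Bool) → Σℚ n (λ i → indℚ (p i)) ≡ ℕ→ℚ (countᵇ p)
  Σℚ-indℚ {zero}  p = refl
  Σℚ-indℚ {suc n} p with p zero
  ... | true  = trans (cong (1ℚ +_) (Σℚ-indℚ (λ i → p (suc i)))) (sym (ℕ→ℚ-suc (countᵇ (λ i → p (suc i)))))
  ... | false = trans (ℚ.+-identityˡ _) (Σℚ-indℚ (λ i → p (suc i)))

module LinearAlgebra where

  open import Data.Nat.Base as ℕ using (ℕ; zero; suc; z≤n; s≤s; _≤_)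
  import Data.Nat.Properties as ℕ
  open import Data.Fin.Base using (Fin; zero; suc; punchIn; _↑ˡ_; _↑ʳ_; splitAt)
  open import Data.Fin.Properties using (any?; splitAt⁻¹-↑ˡ; splitAt⁻¹-↑ʳ)
  open import Data.Product using (Σ; _×_; _,_; proj₁)
  open import Data.Sum using (inj₁; inj₂)
  open import Data.Vec.Functional using (insertAt; tail; _++_)
  open import Data.Vec.Functional.Properties
    using (insertAt-lookup; insertAt-punchIn; lookup-++ˡ; lookup-++ʳ)
  open import Data.Rational.Base using (ℚ; 0ℚ; 1ℚ; _+_; _*_; -_; _-_; 1/_; ≢-nonZero)
  import Data.Rational.Properties as ℚ
  open import Data.Rational.Solver using (module +-*-Solver)
  open import Relation.Nullary using (yes; no; ¬?)
  open import Relation.Nullary.Decidable using (decidable-stable)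
  open import Relation.Binary.PropositionalEquality
  open Σℚ-Properties
  open +-*-Solver using (solve; _:=_; _:+_; _:*_; _:-_; :-_; con)

  infixr 7 _·_

  _·_ : ∀ {n} → Matrix n → Vector n → Vector n
  (A · v) i = Σℚ _ (λ j → A i j * v j)

  linComb : ∀ {n k} → (Fin k → ℚ) → (Fin k → Vector n) → Vector n
  linComb {k = k} c vs i = Σℚ k (λ j → c j * vs j i)

  IndepEigenvectors : ∀ {n} → Matrix n → ℚ → ℕ → Set
  IndepEigenvectors {n} A λ′ m =
    Σ (Fin m → Vector n) λ vs → (∀ j → InEigenspace A λ′ (vs j)) × LinIndep vs

  *-cancelˡ-≡0 : ∀ c a → c ≢ 0ℚ → c * a ≡ 0ℚ → a ≡ 0ℚ
  *-cancelˡ-≡0 c a c≢0 ca≡0 = begin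
    a                 ≡⟨ sym (ℚ.*-identityˡ a) ⟩
    1ℚ * a            ≡⟨ cong (_* a) (sym (ℚ.*-inverseˡ c)) ⟩
    (1/ c) * c * a    ≡⟨ ℚ.*-assoc (1/ c) c a ⟩
    (1/ c) * (c * a)  ≡⟨ cong ((1/ c) *_) ca≡0 ⟩
    (1/ c) * 0ℚ       ≡⟨ ℚ.*-zeroʳ (1/ c) ⟩
    0ℚ                ∎
    where open ≡-Reasoning
          instance _ = ≢-nonZero c≢0

  sub≢0 : ∀ a b → a ≢ b → a - b ≢ 0ℚ
  sub≢0 a b a≢b a-b≡0 = a≢b (begin
    a            ≡⟨ solve 2 (λ a b → a := (a :- b) :+ b) refl a b ⟩
    (a - b) + b  ≡⟨ cong (_+ b) a-b≡0 ⟩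
    0ℚ + b       ≡⟨ ℚ.+-identityˡ b ⟩
    b            ∎)
    where open ≡-Reasoning

  pivots⇒linIndep : ∀ {n k} (vs : Fin k → Vector n) (pivot : Fin k → Fin n) →
    (∀ j → vs j (pivot j) ≡ 1ℚ) → (∀ i j → j ≢ i → vs j (pivot i) ≡ 0ℚ) → LinIndep vs
  pivots⇒linIndep {k = k} vs pivot on off c rel i = begin
    c i
      ≡⟨ sym (ℚ.*-identityʳ (c i)) ⟩
    c i * 1ℚ
      ≡⟨ cong (c i *_) (sym (on i)) ⟩
    c i * vs i (pivot i)
      ≡⟨ sym (Σℚ-δ _ i (λ j j≢i → trans (cong (c j *_) (off i j j≢i)) (ℚ.*-zeroʳ (c j)))) ⟩
    linComb c vs (pivot i)
      ≡⟨ rel (pivot i) ⟩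
    0ℚ ∎
    where open ≡-Reasoning

  linIndep-tail : ∀ {n k} (vs : Fin k → Vector (suc n)) → (∀ j → vs j zero ≡ 0ℚ) →
    LinIndep vs → LinIndep (λ j → tail (vs j))
  linIndep-tail vs head≡0 indep c rel = indep c λ where
    zero    → Σℚ-zero _ (λ j → trans (cong (c j *_) (head≡0 j)) (ℚ.*-zeroʳ (c j)))
    (suc t) → rel t

  linComb-insertAt : ∀ {n k} (c : Fin k → ℚ) (vs : Fin (suc k) → Vector n) j₀ a t →
    linComb (insertAt c j₀ a) vs t ≡ a * vs j₀ t + linComb c (λ i → vs (punchIn j₀ i)) t
  linComb-insertAt c vs j₀ a t = trans (Σℚ-punchIn (λ j → insertAt c j₀ a j * vs j t) j₀) (cong₂ _+_
    (cong (_* vs j₀ t) (insertAt-lookup c j₀ a))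
    (Σℚ-cong (λ i → cong (_* vs (punchIn j₀ i) t) (insertAt-punchIn c j₀ a i))))

  -- One step of Gaussian elimination: clear the first coordinate using the pivot vector vs j₀.
  module Elimination {n k} (vs : Fin (suc k) → Vector (suc n)) (j₀ : Fin (suc k))
                     (pivot≢0 : vs j₀ zero ≢ 0ℚ) where

    private
      instance _ = ≢-nonZero pivot≢0
      pivot = vs j₀ zero
      others : Fin k → Vector (suc n)
      others i = vs (punchIn j₀ i)

    multiplier : Fin k → ℚ
    multiplier i = others i zero * 1/ pivot

    eliminated : Fin k → Vector n
    eliminated i t = others i (suc t) - multiplier i * vs j₀ (suc t)

    others-head : ∀ i → others i zero ≡ multiplier i * pivot
    others-head i = begin
      others i zero                        ≡⟨ sym (ℚ.*-identityʳ _) ⟩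
      others i zero * 1ℚ                   ≡⟨ cong (others i zero *_) (sym (ℚ.*-inverseˡ pivot)) ⟩
      others i zero * (1/ pivot * pivot)   ≡⟨ sym (ℚ.*-assoc (others i zero) (1/ pivot) pivot) ⟩
      multiplier i * pivot                 ∎
      where open ≡-Reasoning

    module _ (c : Fin k → ℚ) where

      X : ℚ
      X = Σℚ k (λ i → c i * multiplier i)

      Σ-multiplier : ∀ x → Σℚ k (λ i → c i * (multiplier i * x)) ≡ X * x
      Σ-multiplier x = trans (Σℚ-cong (λ i → sym (ℚ.*-assoc (c i) (multiplier i) x)))
                             (Σℚ-*ʳ x (λ i → c i * multiplier i))

      linComb-eliminated : ∀ t → linComb c eliminated t ≡ linComb c others (suc t) - X * vs j₀ (suc t)
      linComb-eliminated t = begin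
        linComb c eliminated t
          ≡⟨ Σℚ-cong (λ i → solve 4 (λ c a m b → c :* (a :- m :* b) := c :* a :- c :* (m :* b)) refl
                                    (c i) (others i (suc t)) (multiplier i) (vs j₀ (suc t))) ⟩
        Σℚ k (λ i → c i * others i (suc t) - c i * (multiplier i * vs j₀ (suc t)))
          ≡⟨ Σℚ-sub (λ i → c i * others i (suc t)) (λ i → c i * (multiplier i * vs j₀ (suc t))) ⟩
        linComb c others (suc t) - Σℚ k (λ i → c i * (multiplier i * vs j₀ (suc t)))
          ≡⟨ cong (λ s → linComb c others (suc t) - s) (Σ-multiplier (vs j₀ (suc t))) ⟩
        linComb c others (suc t) - X * vs j₀ (suc t) ∎
        where open ≡-Reasoning

      lift-relation : (∀ t → linComb c eliminated t ≡ 0ℚ) → ∀ t → linComb (insertAt c j₀ (- X)) vs t ≡ 0ℚ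
      lift-relation _ zero = begin
        linComb (insertAt c j₀ (- X)) vs zero
          ≡⟨ linComb-insertAt c vs j₀ (- X) zero ⟩
        - X * pivot + linComb c others zero
          ≡⟨ cong (- X * pivot +_) (Σℚ-cong (λ i → cong (c i *_) (others-head i))) ⟩
        - X * pivot + Σℚ k (λ i → c i * (multiplier i * pivot))
          ≡⟨ cong (- X * pivot +_) (Σ-multiplier pivot) ⟩
        - X * pivot + X * pivot
          ≡⟨ solve 2 (λ x p → (:- x) :* p :+ x :* p := con 0ℚ) refl X pivot ⟩
        0ℚ ∎
        where open ≡-Reasoning
      lift-relation rel (suc t) = begin
        linComb (insertAt c j₀ (- X)) vs (suc t)
          ≡⟨ linComb-insertAt c vs j₀ (- X) (suc t) ⟩
        - X * vs j₀ (suc t) + linComb c others (suc t)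
          ≡⟨ solve 3 (λ x b l → (:- x) :* b :+ l := l :- x :* b) refl X (vs j₀ (suc t)) _ ⟩
        linComb c others (suc t) - X * vs j₀ (suc t)
          ≡⟨ sym (linComb-eliminated t) ⟩
        linComb c eliminated t
          ≡⟨ rel t ⟩
        0ℚ ∎
        where open ≡-Reasoning

    linIndep-eliminated : LinIndep vs → LinIndep eliminated
    linIndep-eliminated indep c rel i = begin
      c i
        ≡⟨ sym (insertAt-punchIn c j₀ (- X c) i) ⟩
      insertAt c j₀ (- X c) (punchIn j₀ i)
        ≡⟨ indep (insertAt c j₀ (- X c)) (lift-relation c rel) (punchIn j₀ i) ⟩
      0ℚ ∎
      where open ≡-Reasoning

  linIndep⇒≤ : ∀ n {k} (vs : Fin k → Vector n) → LinIndep vs → k ≤ n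
  linIndep⇒≤ n       {zero}  vs indep = z≤n
  linIndep⇒≤ zero    {suc k} vs indep with () ← indep (λ _ → 1ℚ) (λ ()) zero
  linIndep⇒≤ (suc n) {suc k} vs indep with any? (λ j → ¬? (vs j zero ℚ.≟ 0ℚ))
  ... | yes (j₀ , pivot≢0) = s≤s (linIndep⇒≤ n eliminated (linIndep-eliminated indep))
    where open Elimination vs j₀ pivot≢0
  ... | no noPivot = ℕ.m≤n⇒m≤1+n (linIndep⇒≤ n (λ j → tail (vs j)) (linIndep-tail vs head≡0 indep))
    where
    head≡0 : ∀ j → vs j zero ≡ 0ℚ
    head≡0 j = decidable-stable (vs j zero ℚ.≟ 0ℚ) (λ ≢0 → noPivot (j , ≢0))

  ·-+ : ∀ {n} (A : Matrix n) v w i → (A · (λ j → v j + w j)) i ≡ (A · v) i + (A · w) i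
  ·-+ A v w i = trans (Σℚ-cong (λ j → ℚ.*-distribˡ-+ (A i j) (v j) (w j)))
                      (Σℚ-+ (λ j → A i j * v j) (λ j → A i j * w j))

  ·-sub : ∀ {n} (A : Matrix n) v w i → (A · (λ j → v j - w j)) i ≡ (A · v) i - (A · w) i
  ·-sub A v w i = trans (Σℚ-cong (λ j → solve 3 (λ a v w → a :* (v :- w) := a :* v :- a :* w) refl (A i j) (v j) (w j)))
                        (Σℚ-sub (λ j → A i j * v j) (λ j → A i j * w j))

  ·-*ˡ : ∀ {n} (A : Matrix n) c v i → (A · (λ j → c * v j)) i ≡ c * (A · v) i
  ·-*ˡ A c v i = trans (Σℚ-cong (λ j → solve 3 (λ a c v → a :* (c :* v) := c :* (a :* v)) refl (A i j) c (v j)))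
                       (Σℚ-*ˡ c (λ j → A i j * v j))

  ·-zero : ∀ {n} (A : Matrix n) v → (∀ j → v j ≡ 0ℚ) → ∀ i → (A · v) i ≡ 0ℚ
  ·-zero A v v≡0 i = Σℚ-zero _ (λ j → trans (cong (A i j *_) (v≡0 j)) (ℚ.*-zeroʳ (A i j)))

  InEigenspace-*ˡ : ∀ {n} (A : Matrix n) λ′ c v → InEigenspace A λ′ v → InEigenspace A λ′ (λ i → c * v i)
  InEigenspace-*ˡ A λ′ c v Av≡λv i = begin
    (A · (λ j → c * v j)) i   ≡⟨ ·-*ˡ A c v i ⟩
    c * (A · v) i             ≡⟨ cong (c *_) (Av≡λv i) ⟩
    c * (λ′ * v i)            ≡⟨ solve 3 (λ c l v → c :* (l :* v) := l :* (c :* v)) refl c λ′ (v i) ⟩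
    λ′ * (c * v i)            ∎
    where open ≡-Reasoning

  InEigenspace-linComb : ∀ {n k} (A : Matrix n) λ′ (c : Fin k → ℚ) (vs : Fin k → Vector n) →
    (∀ j → InEigenspace A λ′ (vs j)) → InEigenspace A λ′ (linComb c vs)
  InEigenspace-linComb {n} {k} A λ′ c vs eigen i = begin
    Σℚ n (λ t → A i t * Σℚ k (λ j → c j * vs j t))
      ≡⟨ Σℚ-cong (λ t → sym (Σℚ-*ˡ (A i t) (λ j → c j * vs j t))) ⟩
    Σℚ n (λ t → Σℚ k (λ j → A i t * (c j * vs j t)))
      ≡⟨ Σℚ-comm (λ t j → A i t * (c j * vs j t)) ⟩
    Σℚ k (λ j → (A · (λ t → c j * vs j t)) i)
      ≡⟨ Σℚ-cong (λ j → InEigenspace-*ˡ A λ′ (c j) (vs j) (eigen j) i) ⟩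
    Σℚ k (λ j → λ′ * (c j * vs j i))
      ≡⟨ Σℚ-*ˡ λ′ (λ j → c j * vs j i) ⟩
    λ′ * linComb c vs i ∎
    where open ≡-Reasoning

  eigen₂-sum≡0 : ∀ {n} (A : Matrix n) {λ₁ λ₂} v w → λ₁ ≢ λ₂ →
    InEigenspace A λ₁ v → InEigenspace A λ₂ w → (∀ i → v i + w i ≡ 0ℚ) → ∀ i → v i ≡ 0ℚ
  eigen₂-sum≡0 A {λ₁} {λ₂} v w λ₁≢λ₂ v∈E₁ w∈E₂ v+w≡0 i =
    *-cancelˡ-≡0 (λ₁ - λ₂) (v i) (sub≢0 λ₁ λ₂ λ₁≢λ₂) (begin
      (λ₁ - λ₂) * v i
        ≡⟨ solve 4 (λ a b v w → (a :- b) :* v := (a :* v :+ b :* w) :- b :* (v :+ w)) refl λ₁ λ₂ (v i) (w i) ⟩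
      (λ₁ * v i + λ₂ * w i) - λ₂ * (v i + w i)
        ≡⟨ cong₂ (λ p q → p - λ₂ * q) A[v+w]≡0 (v+w≡0 i) ⟩
      0ℚ - λ₂ * 0ℚ
        ≡⟨ solve 1 (λ b → con 0ℚ :- b :* con 0ℚ := con 0ℚ) refl λ₂ ⟩
      0ℚ ∎)
    where
    open ≡-Reasoning
    A[v+w]≡0 : λ₁ * v i + λ₂ * w i ≡ 0ℚ
    A[v+w]≡0 = begin
      λ₁ * v i + λ₂ * w i            ≡⟨ sym (cong₂ _+_ (v∈E₁ i) (w∈E₂ i)) ⟩
      (A · v) i + (A · w) i          ≡⟨ sym (·-+ A v w i) ⟩
      (A · (λ j → v j + w j)) i      ≡⟨ ·-zero A _ v+w≡0 i ⟩
      0ℚ                             ∎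

  eigen₃-sum≡0 : ∀ {n} (A : Matrix n) {λ₁ λ₂ λ₃} v w x → λ₁ ≢ λ₂ → λ₁ ≢ λ₃ →
    InEigenspace A λ₁ v → InEigenspace A λ₂ w → InEigenspace A λ₃ x →
    (∀ i → v i + w i + x i ≡ 0ℚ) → ∀ i → v i ≡ 0ℚ
  eigen₃-sum≡0 A {λ₁} {λ₂} {λ₃} v w x λ₁≢λ₂ λ₁≢λ₃ v∈E₁ w∈E₂ x∈E₃ v+w+x≡0 i =
    *-cancelˡ-≡0 (λ₁ - λ₃) (v i) (sub≢0 λ₁ λ₃ λ₁≢λ₃)
      (eigen₂-sum≡0 A (λ t → (λ₁ - λ₃) * v t) (λ t → (λ₂ - λ₃) * w t) λ₁≢λ₂
        (InEigenspace-*ˡ A λ₁ (λ₁ - λ₃) v v∈E₁) (InEigenspace-*ˡ A λ₂ (λ₂ - λ₃) w w∈E₂) shifted≡0 i)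
    where
    open ≡-Reasoning
    -- Apply A - λ₃ to v + w + x = 0.
    shifted≡0 : ∀ t → (λ₁ - λ₃) * v t + (λ₂ - λ₃) * w t ≡ 0ℚ
    shifted≡0 t = begin
      (λ₁ - λ₃) * v t + (λ₂ - λ₃) * w t
        ≡⟨ solve 6 (λ a b c v w x → (a :- c) :* v :+ (b :- c) :* w
                                    := (a :* v :+ b :* w :+ c :* x) :- c :* (v :+ w :+ x))
                   refl λ₁ λ₂ λ₃ (v t) (w t) (x t) ⟩
      (λ₁ * v t + λ₂ * w t + λ₃ * x t) - λ₃ * (v t + w t + x t)
        ≡⟨ cong₂ (λ p q → p - λ₃ * q) A[v+w+x]≡0 (v+w+x≡0 t) ⟩
      0ℚ - λ₃ * 0ℚ
        ≡⟨ solve 1 (λ c → con 0ℚ :- c :* con 0ℚ := con 0ℚ) refl λ₃ ⟩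
      0ℚ ∎
      where
      A[v+w+x]≡0 : λ₁ * v t + λ₂ * w t + λ₃ * x t ≡ 0ℚ
      A[v+w+x]≡0 = begin
        λ₁ * v t + λ₂ * w t + λ₃ * x t            ≡⟨ sym (cong₂ _+_ (cong₂ _+_ (v∈E₁ t) (w∈E₂ t)) (x∈E₃ t)) ⟩
        (A · v) t + (A · w) t + (A · x) t         ≡⟨ sym (cong (_+ (A · x) t) (·-+ A v w t)) ⟩
        (A · (λ j → v j + w j)) t + (A · x) t     ≡⟨ sym (·-+ A (λ j → v j + w j) x t) ⟩
        (A · (λ j → v j + w j + x j)) t           ≡⟨ ·-zero A _ v+w+x≡0 t ⟩
        0ℚ                                        ∎

  ↑-elim : ∀ {m k} {P : Fin (m ℕ.+ k) → Set} → (∀ i → P (i ↑ˡ k)) → (∀ j → P (m ↑ʳ j)) → ∀ i → P i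
  ↑-elim {m} {k} {P} onˡ onʳ i with splitAt m i in eq
  ... | inj₁ j = subst P (splitAt⁻¹-↑ˡ eq) (onˡ j)
  ... | inj₂ j = subst P (splitAt⁻¹-↑ʳ eq) (onʳ j)

  linComb-++ : ∀ {n m k} (c : Fin (m ℕ.+ k) → ℚ) (F : Fin m → Vector n) (G : Fin k → Vector n) i →
    linComb c (F ++ G) i ≡ linComb (λ j → c (j ↑ˡ k)) F i + linComb (λ j → c (m ↑ʳ j)) G i
  linComb-++ {m = m} {k} c F G i = trans (Σℚ-↑ m k (λ j → c j * (F ++ G) j i)) (cong₂ _+_
    (Σℚ-cong (λ j → cong (λ u → c (j ↑ˡ k) * u i) (lookup-++ˡ F G j)))
    (Σℚ-cong (λ j → cong (λ u → c (m ↑ʳ j) * u i) (lookup-++ʳ F G j))))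

  linIndep-++₃ : ∀ {n k₁ k₂ k₃} (A : Matrix n) {λ₁ λ₂ λ₃} → λ₁ ≢ λ₂ → λ₁ ≢ λ₃ → λ₂ ≢ λ₃ →
    (E₁ : IndepEigenvectors A λ₁ k₁) (E₂ : IndepEigenvectors A λ₂ k₂) (E₃ : IndepEigenvectors A λ₃ k₃) →
    LinIndep ((proj₁ E₁ ++ proj₁ E₂) ++ proj₁ E₃)
  linIndep-++₃ {k₁ = k₁} {k₂} {k₃} A {λ₁} {λ₂} {λ₃} λ₁≢λ₂ λ₁≢λ₃ λ₂≢λ₃
               (F₁ , eigen₁ , indep₁) (F₂ , eigen₂ , indep₂) (F₃ , eigen₃ , indep₃) c rel =
    ↑-elim (↑-elim (indep₁ c₁ v≡0) (indep₂ c₂ w≡0)) (indep₃ c₃ x≡0)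
    where
    c₁ = λ j → c ((j ↑ˡ k₂) ↑ˡ k₃)
    c₂ = λ j → c ((k₁ ↑ʳ j) ↑ˡ k₃)
    c₃ = λ j → c ((k₁ ℕ.+ k₂) ↑ʳ j)
    v = linComb c₁ F₁
    w = linComb c₂ F₂
    x = linComb c₃ F₃
    v+w+x≡0 : ∀ i → v i + w i + x i ≡ 0ℚ
    v+w+x≡0 i = begin
      v i + w i + x i
        ≡⟨ cong (_+ x i) (sym (linComb-++ (λ j → c (j ↑ˡ k₃)) F₁ F₂ i)) ⟩
      linComb (λ j → c (j ↑ˡ k₃)) (F₁ ++ F₂) i + x i
        ≡⟨ sym (linComb-++ c (F₁ ++ F₂) F₃ i) ⟩
      linComb c ((F₁ ++ F₂) ++ F₃) i
        ≡⟨ rel i ⟩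
      0ℚ ∎
      where open ≡-Reasoning
    v∈E₁ = InEigenspace-linComb A λ₁ c₁ F₁ eigen₁
    w∈E₂ = InEigenspace-linComb A λ₂ c₂ F₂ eigen₂
    x∈E₃ = InEigenspace-linComb A λ₃ c₃ F₃ eigen₃
    v≡0 = eigen₃-sum≡0 A v w x λ₁≢λ₂ λ₁≢λ₃ v∈E₁ w∈E₂ x∈E₃ v+w+x≡0
    w≡0 = eigen₃-sum≡0 A w v x (≢-sym λ₁≢λ₂) λ₂≢λ₃ w∈E₂ v∈E₁ x∈E₃
            (λ i → trans (cong (_+ x i) (ℚ.+-comm (w i) (v i))) (v+w+x≡0 i))
    x≡0 = eigen₃-sum≡0 A x v w (≢-sym λ₁≢λ₃) (≢-sym λ₂≢λ₃) x∈E₃ v∈E₁ w∈E₂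
            (λ i → trans (solve 3 (λ x v w → x :+ v :+ w := v :+ w :+ x) refl (x i) (v i) (w i)) (v+w+x≡0 i))

  module _ {n} (A : Matrix n) {λ₁ λ₂ λ₃ : ℚ} (λ₁≢λ₂ : λ₁ ≢ λ₂) (λ₁≢λ₃ : λ₁ ≢ λ₃) (λ₂≢λ₃ : λ₂ ≢ λ₃) where

    indepEigenvectors₃-≤ : ∀ {m₁ m₂ m₃} → IndepEigenvectors A λ₁ m₁ → IndepEigenvectors A λ₂ m₂ →
      IndepEigenvectors A λ₃ m₃ → m₁ ℕ.+ m₂ ℕ.+ m₃ ≤ n
    indepEigenvectors₃-≤ E₁ E₂ E₃ = linIndep⇒≤ n _ (linIndep-++₃ A λ₁≢λ₂ λ₁≢λ₃ λ₂≢λ₃ E₁ E₂ E₃)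

    hasEigMult-maximal : ∀ {m₁ m₂ m₃} → m₁ ℕ.+ m₂ ℕ.+ m₃ ≡ n → IndepEigenvectors A λ₁ m₁ →
      IndepEigenvectors A λ₂ m₂ → IndepEigenvectors A λ₃ m₃ → HasEigMult A λ₁ m₁
    hasEigMult-maximal total E₁ E₂ E₃ =
      E₁ , λ vs eigen indep → ℕ.<-irrefl total (indepEigenvectors₃-≤ (vs , eigen , indep) E₂ E₃)

  hasEigMult₃ : ∀ {n m₁ m₂ m₃} (A : Matrix n) {λ₁ λ₂ λ₃} → λ₁ ≢ λ₂ → λ₁ ≢ λ₃ → λ₂ ≢ λ₃ →
    m₁ ℕ.+ m₂ ℕ.+ m₃ ≡ n →
    IndepEigenvectors A λ₁ m₁ → IndepEigenvectors A λ₂ m₂ → IndepEigenvectors A λ₃ m₃ →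
    HasEigMult A λ₁ m₁ × HasEigMult A λ₂ m₂ × HasEigMult A λ₃ m₃
  hasEigMult₃ {m₁ = m₁} {m₂} {m₃} A λ₁≢λ₂ λ₁≢λ₃ λ₂≢λ₃ total E₁ E₂ E₃ =
    hasEigMult-maximal A λ₁≢λ₂ λ₁≢λ₃ λ₂≢λ₃ total E₁ E₂ E₃ ,
    hasEigMult-maximal A (≢-sym λ₁≢λ₂) λ₂≢λ₃ λ₁≢λ₃
      (trans (cong (ℕ._+ m₃) (ℕ.+-comm m₂ m₁)) total) E₂ E₁ E₃ ,
    hasEigMult-maximal A (≢-sym λ₁≢λ₃) (≢-sym λ₂≢λ₃) λ₁≢λ₂
      (trans (trans (ℕ.+-assoc m₃ m₁ m₂) (ℕ.+-comm m₃ (m₁ ℕ.+ m₂))) total) E₃ E₁ E₂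

module FinAbelianGroups where

  open import Data.Bool.Base using (Bool; true; false)
  open import Data.Nat.Base as ℕ using (ℕ)
  import Data.Nat.Properties as ℕ
  open import Data.Fin.Base using (Fin)
  import Data.Fin.Properties as Fin
  open import Data.Maybe.Base using (just; nothing; fromMaybe)
  open import Data.Empty using (⊥-elim)
  open import Function.Base using (_∘_; case_of_)
  open import Relation.Nullary using (yes; does)
  open import Relation.Nullary.Decidable using (dec-true; dec-false)
  open import Relation.Unary using (Pred; Decidable)
  open import Relation.Binary.PropositionalEquality
  open import Algebra.Core using (Op₁; Op₂)
  open import Algebra.Structures using (IsAbelianGroup)
  open import Algebra.Bundles using (AbelianGroup)
  open BooleanPredicates

  record FinAbelianGroup (n : ℕ) : Set where
    infixl 6 _+_ _-_
    infix  8 -_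
    field
      _+_ : Op₂ (Fin n)
      0#  : Fin n
      -_  : Op₁ (Fin n)
      isAbelianGroup : IsAbelianGroup _≡_ _+_ 0# -_

    _-_ : Op₂ (Fin n)
    a - b = a + (- b)

    open IsAbelianGroup isAbelianGroup public
      using (assoc; comm; identityˡ; identityʳ; inverseˡ; inverseʳ)

    abelianGroup : AbelianGroup 0ℓ 0ℓ
    abelianGroup = record { isAbelianGroup = isAbelianGroup }

    open import Algebra.Properties.AbelianGroup abelianGroup public
      using (⁻¹-anti-homo‿-; //-rightDividesˡ)
    open ≡-Reasoning

    sub-self : ∀ a → a - a ≡ 0#
    sub-self = inverseʳ

    sub-+-cancel : ∀ a b → (a - b) + b ≡ a
    sub-+-cancel a b = //-rightDividesˡ b a

    +-sub-cancel : ∀ a b → b + (a - b) ≡ a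
    +-sub-cancel a b = trans (comm b (a - b)) (sub-+-cancel a b)

    sub-+-sub : ∀ a b c → (a - b) + (b - c) ≡ a - c
    sub-+-sub a b c = begin
      (a - b) + (b - c)  ≡⟨ sym (assoc (a - b) b (- c)) ⟩
      (a - b) + b - c    ≡⟨ cong (_- c) (sub-+-cancel a b) ⟩
      a - c              ∎

    sub-sub-cancel : ∀ a b → a - (a - b) ≡ b
    sub-sub-cancel a b = trans (cong (a +_) (⁻¹-anti-homo‿- a b)) (+-sub-cancel b a)

    sub-sub-comm : ∀ a b c → a - b - c ≡ a - c - b
    sub-sub-comm a b c = begin
      a - b - c          ≡⟨ assoc a (- b) (- c) ⟩
      a + (- b + - c)    ≡⟨ cong (a +_) (comm (- b) (- c)) ⟩
      a + (- c + - b)    ≡⟨ sym (assoc a (- c) (- b)) ⟩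
      a - c - b          ∎

    sub-sub-sub : ∀ a b c → (a - b) - (a - c) ≡ c - b
    sub-sub-sub a b c = begin
      (a - b) - (a - c)  ≡⟨ cong ((a - b) +_) (⁻¹-anti-homo‿- a c) ⟩
      (a - b) + (c - a)  ≡⟨ comm (a - b) (c - a) ⟩
      (c - a) + (a - b)  ≡⟨ sub-+-sub c a b ⟩
      c - b              ∎

  record IsDecSubgroup {n} (G : FinAbelianGroup n) (H : Pred (Fin n) 0ℓ) : Set where
    open FinAbelianGroup G
    field
      dec        : Decidable H
      0∈         : H 0#
      +-closed   : ∀ {a b} → H a → H b → H (a + b)
      neg-closed : ∀ {a} → H a → H (- a)

    sub-closed : ∀ {a b} → H a → H b → H (a - b)
    sub-closed a∈ b∈ = +-closed a∈ (neg-closed b∈)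

    infix 4 _∼_
    _∼_ : Fin n → Fin n → Set
    a ∼ b = H (a - b)

    ∼-refl : ∀ a → a ∼ a
    ∼-refl a = subst H (sym (sub-self a)) 0∈

    ∼-sym : ∀ {a b} → a ∼ b → b ∼ a
    ∼-sym {a} {b} a∼b = subst H (⁻¹-anti-homo‿- a b) (neg-closed a∼b)

    ∼-trans : ∀ {a b c} → a ∼ b → b ∼ c → a ∼ c
    ∼-trans {a} {b} {c} a∼b b∼c = subst H (sub-+-sub a b c) (+-closed a∼b b∼c)

    χ : Fin n → Bool
    χ a = does (dec a)

    χ-∼ : ∀ {a b} → a ∼ b → χ a ≡ χ b
    χ-∼ {a} {b} a∼b = does-⇔ (dec a) (dec b)
      (λ a∈H → subst H (sub-sub-cancel a b) (sub-closed a∈H a∼b))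
      (λ b∈H → subst H (sub-+-cancel a b) (+-closed a∼b b∈H))

    χ-∼-sub : ∀ {u v} → u ∼ v → ∀ w → χ (u - w) ≡ χ (v - w)
    χ-∼-sub u∼v w = does-⇔ (dec _) (dec _) (∼-trans (∼-sym u∼v)) (∼-trans u∼v)

    χ-sub : ∀ {v} y → H v → χ (y - v) ≡ χ y
    χ-sub {v} y v∈H = does-⇔ (dec (y - v)) (dec y)
      (λ y-v∈H → subst H (sub-+-cancel y v) (+-closed y-v∈H v∈H)) (λ y∈H → sub-closed y∈H v∈H)

  module Cosets {n} {G : FinAbelianGroup n} {H} (H-sub : IsDecSubgroup G H) where

    open FinAbelianGroup G
    open IsDecSubgroup H-sub public
    open FinSums ℕ.+-*-commutativeSemiring
      using (sum; sum-δ; ∑-comm; *-distribʳ-sum; sum-involution; sum-cong-≗; sum-zero)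

    rep : Fin n → Fin n
    rep u = fromMaybe u (firstᵇ (λ w → χ (u - w)))

    rep-∼ : ∀ u → u ∼ rep u
    rep-∼ u with firstᵇ (λ w → χ (u - w)) in eq
    ... | nothing = ∼-refl u
    ... | just w  = does-true (dec (u - w)) (firstᵇ-true (λ w → χ (u - w)) eq)

    rep-cong : ∀ {u v} → u ∼ v → rep u ≡ rep v
    rep-cong {u} {v} u∼v
      with firstᵇ (λ w → χ (u - w)) in eq | firstᵇ (λ w → χ (v - w)) | firstᵇ-cong (χ-∼-sub u∼v)
    ... | just w  | .(just w)  | refl = refl
    ... | nothing | .nothing   | refl = ⊥-elim (firstᵇ-nothing _ eq (dec-true (dec (u - u)) (∼-refl u)))

    isRep : Fin n → Bool
    isRep w = does (rep w Fin.≟ w)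

    isRep⇒rep≡ : ∀ {w} → isRep w ≡ true → rep w ≡ w
    isRep⇒rep≡ {w} isRep-w with rep w Fin.≟ w
    ... | yes rep≡ = rep≡

    isRep-rep : ∀ u → isRep (rep u) ≡ true
    isRep-rep u = dec-true (rep (rep u) Fin.≟ rep u) (rep-cong (∼-sym (rep-∼ u)))

    isRep-∼⇒≡ : ∀ {a b} → isRep a ≡ true → isRep b ≡ true → a ∼ b → a ≡ b
    isRep-∼⇒≡ isRep-a isRep-b a∼b =
      trans (sym (isRep⇒rep≡ isRep-a)) (trans (rep-cong a∼b) (isRep⇒rep≡ isRep-b))

    rep≡⇒isRep : ∀ u {w} → rep u ≡ w → isRep w ≡ true
    rep≡⇒isRep u refl = isRep-rep u

    coset-size : ∀ w → countᵇ (λ u → does (rep u Fin.≟ w)) ≡ ind (isRep w) ℕ.* countᵇ χ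
    coset-size w with isRep w in isRep-w
    ... | false = sum-zero _ λ u → cong ind (dec-false (rep u Fin.≟ w) λ rep≡w →
                    case trans (sym isRep-w) (rep≡⇒isRep u rep≡w) of λ ())
    ... | true  = begin
      countᵇ (λ u → does (rep u Fin.≟ w))  ≡⟨ sum-cong-≗ (λ u → cong ind (rep≡⇔∼ u)) ⟩
      countᵇ (λ u → χ (w - u))             ≡⟨ sym (sum-involution (λ u → ind (χ u)) (λ u → w - u) (sub-sub-cancel w)) ⟩
      countᵇ χ                             ≡⟨ sym (ℕ.+-identityʳ _) ⟩
      1 ℕ.* countᵇ χ                       ∎
      where
      open ≡-Reasoning
      rep≡⇔∼ : ∀ u → does (rep u Fin.≟ w) ≡ χ (w - u)
      rep≡⇔∼ u = does-⇔ (rep u Fin.≟ w) (dec (w - u))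
        (λ rep≡w → subst (_∼ u) rep≡w (∼-sym (rep-∼ u)))
        (λ w∼u → trans (rep-cong (∼-sym w∼u)) (isRep⇒rep≡ isRep-w))

    lagrange : countᵇ isRep ℕ.* countᵇ χ ≡ n
    lagrange = begin
      countᵇ isRep ℕ.* countᵇ χ                         ≡⟨ *-distribʳ-sum (countᵇ χ) (λ w → ind (isRep w)) ⟩
      sum (λ w → ind (isRep w) ℕ.* countᵇ χ)            ≡⟨ sum-cong-≗ (λ w → sym (coset-size w)) ⟩
      sum (λ w → countᵇ (λ u → does (rep u Fin.≟ w)))   ≡⟨ ∑-comm (λ w u → ind (does (rep u Fin.≟ w))) ⟩
      sum (λ u → countᵇ (λ w → does (rep u Fin.≟ w)))   ≡⟨ sum-cong-≗ one-rep ⟩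
      countᵇ {n} (λ _ → true)                           ≡⟨ countᵇ-true n ⟩
      n                                                 ∎
      where
      open ≡-Reasoning
      one-rep : ∀ u → countᵇ (λ w → does (rep u Fin.≟ w)) ≡ 1
      one-rep u = trans (sum-δ _ (rep u) λ w w≢rep → cong ind (dec-false (rep u Fin.≟ w) (w≢rep ∘ sym)))
                        (cong ind (dec-true (rep u Fin.≟ rep u) refl))

  module _ {n} {G : FinAbelianGroup n} {M I} (M-sub : IsDecSubgroup G M) (I-sub : IsDecSubgroup G I)
           (M⊆I : ∀ {a} → M a → I a) where

    open FinAbelianGroup G
    private
      module M = Cosets M-sub
      module I = Cosets I-sub

    isRep-⊆ : ∀ w → I.isRep w ≡ true → M.isRep w ≡ true
    isRep-⊆ w isRepᵢ with firstᵇ (λ v → I.χ (w - v)) in firstᵢ | I.isRep⇒rep≡ isRepᵢ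
    ... | nothing | _    = ⊥-elim (firstᵇ-nothing _ firstᵢ (dec-true (I.dec (w - w)) (I.∼-refl w)))
    ... | just .w | refl = dec-true (M.rep w Fin.≟ w)
      (cong (fromMaybe w) (firstᵇ-⊆ χM⊆χI firstᵢ (dec-true (M.dec (w - w)) (M.∼-refl w))))
      where
      χM⊆χI : ∀ v → M.χ (w - v) ≡ true → I.χ (w - v) ≡ true
      χM⊆χI v χM = dec-true (I.dec (w - v)) (M⊆I (does-true (M.dec (w - v)) χM))

module QuotientArithmetic where

  open import Data.Nat.Base using (suc; _+_; _*_)
  open import Data.Nat.Properties using (+-cancelˡ-≡; *-suc)
  open import Data.Nat.Solver using (module +-*-Solver)
  open +-*-Solver using (solve; _:=_; _:+_; _:*_; con)
  open import Relation.Binary.PropositionalEquality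
  open ≡-Reasoning

  -- With a = n/i, a + b = n/k and s = i - k this says b = n/k - n/i, stated without division or ∸.
  difference-of-quotients : ∀ a b i k s n → a * i ≡ n → (a + b) * k ≡ n → s + k ≡ i → b * (i * k) ≡ n * s
  difference-of-quotients a b i k s n ai≡n [a+b]k≡n s+k≡i = +-cancelˡ-≡ (n * k) _ _ (begin
    n * k + b * (i * k)
      ≡⟨ cong (λ t → t * k + b * (i * k)) (sym ai≡n) ⟩
    a * i * k + b * (i * k)
      ≡⟨ solve 4 (λ a b i k → a :* i :* k :+ b :* (i :* k) := (a :+ b) :* k :* i) refl a b i k ⟩
    (a + b) * k * i
      ≡⟨ cong (_* i) [a+b]k≡n ⟩
    n * i
      ≡⟨ cong (n *_) (sym s+k≡i) ⟩
    n * (s + k)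
      ≡⟨ solve 3 (λ n s k → n :* (s :+ k) := n :* k :+ n :* s) refl n s k ⟩
    n * k + n * s ∎)

  complement-of-quotient : ∀ t c k n → t + c ≡ n → t * suc k ≡ n → c * suc k ≡ n * k
  complement-of-quotient t c k n t+c≡n t[1+k]≡n = +-cancelˡ-≡ n _ _ (begin
    n + c * suc k
      ≡⟨ cong (_+ c * suc k) (sym t[1+k]≡n) ⟩
    t * suc k + c * suc k
      ≡⟨ solve 3 (λ t c k → t :* (con 1 :+ k) :+ c :* (con 1 :+ k) := (t :+ c) :* (con 1 :+ k)) refl t c k ⟩
    (t + c) * suc k
      ≡⟨ cong (_* suc k) t+c≡n ⟩
    n * suc k
      ≡⟨ *-suc n k ⟩
    n + n * k ∎)

open FinAbelianGroups using (FinAbelianGroup; module FinAbelianGroup; IsDecSubgroup)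

cayleyMatrix : ∀ {n} (G : FinAbelianGroup n) {S : Pred (Fin n) 0ℓ} → Decidable S → Matrix n
cayleyMatrix G S? u v = Σℚ-Properties.indℚ (does (S? (FinAbelianGroup._-_ G u v)))

module CayleyGraphOfSubgroupDifference
  {n} (G : FinAbelianGroup n) {I M S : Pred (Fin n) 0ℓ}
  (I-sub : IsDecSubgroup G I) (M-sub : IsDecSubgroup G M)
  (M⊆I : ∀ {a} → M a → I a)
  (S? : Decidable S) (S⇔I∖M : ∀ {a} → S a ⇔ (I a × ¬ M a)) (S-nonempty : ∃ S)
  (A : Matrix n) (A-entry : ∀ u v → A u v ≡ cayleyMatrix G S? u v)
  where

  open import Data.Bool.Base using (Bool; true; false; not; _∧_)
  open import Data.Nat.Base as ℕ using (ℕ)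
  import Data.Nat.Properties as ℕₚ
  import Data.Fin.Properties as Fin
  open import Data.Product using (_,_; proj₁; proj₂)
  open import Function.Base using (_∘_)
  open import Data.Rational.Base as ℚ using (0ℚ; 1ℚ)
  import Data.Rational.Properties as ℚₚ
  open import Data.Rational.Solver using (module +-*-Solver)
  open +-*-Solver using (solve; _:=_; _:*_; _:-_; :-_)
  open import Relation.Nullary using (¬?; _×-dec_)
  open import Relation.Nullary.Decidable using (dec-true; dec-false)
  open import Relation.Binary.PropositionalEquality
  open FinAbelianGroups using (module Cosets; isRep-⊆)
  open FinAbelianGroup G
  open BooleanPredicates
  open Σℚ-Properties
  open ℕ→ℚ-Properties
  open LinearAlgebra
  open QuotientArithmetic
  module I = Cosets I-sub
  module M = Cosets M-sub

  χS : Fin n → Bool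
  χS a = does (S? a)

  |I| |M| |S| : ℕ
  |I| = countᵇ I.χ
  |M| = countᵇ M.χ
  |S| = countᵇ χS

  χS≡ : ∀ a → χS a ≡ I.χ a ∧ not (M.χ a)
  χS≡ a = does-⇔ (S? a) (I.dec a ×-dec ¬? (M.dec a))
                 (Equivalence.to S⇔I∖M) (Equivalence.from S⇔I∖M)

  χM⊆χI : ∀ a → M.χ a ≡ true → I.χ a ≡ true
  χM⊆χI a χMa = dec-true (I.dec a) (M⊆I (does-true (M.dec a) χMa))

  |S|+|M|≡|I| : |S| ℕ.+ |M| ≡ |I|
  |S|+|M|≡|I| = countᵇ-+ χS M.χ I.χ (λ a → trans (cong (λ b → ind b ℕ.+ ind (M.χ a)) (χS≡ a))
                                                  (ind-∧-not (I.χ a) (M.χ a) (χM⊆χI a)))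

  indℚ-χS : ∀ a → indℚ (χS a) ≡ indℚ (I.χ a) ℚ.- indℚ (M.χ a)
  indℚ-χS a = trans (cong indℚ (χS≡ a)) (indℚ-∧-not (I.χ a) (M.χ a) (χM⊆χI a))

  S-stable : ∀ {a b} → M (a - b) → S b → S a
  S-stable {a} {b} a∼b b∈S = Equivalence.from S⇔I∖M (a∈I , a∉M)
    where
    b∈I∖M = Equivalence.to S⇔I∖M b∈S
    a∈I = subst I (sub-+-cancel a b) (I.+-closed (M⊆I a∼b) (proj₁ b∈I∖M))
    a∉M = λ a∈M → proj₂ b∈I∖M (subst M (sub-sub-cancel a b) (M.sub-closed a∈M a∼b))

  χS-stable : ∀ {a b} → M (a - b) → χS a ≡ χS b
  χS-stable a∼b = does-⇔ (S? _) (S? _) (S-stable (M.∼-sym a∼b)) (S-stable a∼b)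

  𝟙ᴵ 𝟙ᴹ δ : Fin n → Vector n
  𝟙ᴵ a z = indℚ (I.χ (z - a))
  𝟙ᴹ a z = indℚ (M.χ (z - a))
  δ  a z = indℚ (does (z Fin.≟ a))

  A·-reindex : ∀ f z → (A · f) z ≡ Σℚ n (λ v → indℚ (χS v) ℚ.* f (z - v))
  A·-reindex f z = begin
    Σℚ n (λ v → A z v ℚ.* f v)
      ≡⟨ Σℚ-cong (λ v → cong (ℚ._* f v) (A-entry z v)) ⟩
    Σℚ n (λ v → indℚ (χS (z - v)) ℚ.* f v)
      ≡⟨ Σℚ-involution _ (λ v → z - v) (sub-sub-cancel z) ⟩
    Σℚ n (λ v → indℚ (χS (z - (z - v))) ℚ.* f (z - v))
      ≡⟨ Σℚ-cong (λ v → cong (λ u → indℚ (χS u) ℚ.* f (z - v)) (sub-sub-cancel z v)) ⟩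
    Σℚ n (λ v → indℚ (χS v) ℚ.* f (z - v)) ∎
    where open ≡-Reasoning

  A·𝟙ᴵ : ∀ a z → (A · 𝟙ᴵ a) z ≡ ℕ→ℚ |S| ℚ.* 𝟙ᴵ a z
  A·𝟙ᴵ a z = begin
    (A · 𝟙ᴵ a) z
      ≡⟨ A·-reindex (𝟙ᴵ a) z ⟩
    Σℚ n (λ v → indℚ (χS v) ℚ.* indℚ (I.χ (z - v - a)))
      ≡⟨ Σℚ-cong (λ v → indℚ-*-congʳ (χS v) _ _ (χᴵ-shift v)) ⟩
    Σℚ n (λ v → indℚ (χS v) ℚ.* 𝟙ᴵ a z)
      ≡⟨ Σℚ-*ʳ (𝟙ᴵ a z) (λ v → indℚ (χS v)) ⟩
    Σℚ n (λ v → indℚ (χS v)) ℚ.* 𝟙ᴵ a z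
      ≡⟨ cong (ℚ._* 𝟙ᴵ a z) (Σℚ-indℚ χS) ⟩
    ℕ→ℚ |S| ℚ.* 𝟙ᴵ a z ∎
    where
    open ≡-Reasoning
    χᴵ-shift : ∀ v → χS v ≡ true → I.χ (z - v - a) ≡ I.χ (z - a)
    χᴵ-shift v χSv = trans (cong I.χ (sub-sub-comm z v a))
                           (I.χ-sub (z - a) (proj₁ (Equivalence.to S⇔I∖M (does-true (S? v) χSv))))

  A·𝟙ᴹ : ∀ a z → (A · 𝟙ᴹ a) z ≡ indℚ (χS (z - a)) ℚ.* ℕ→ℚ |M|
  A·𝟙ᴹ a z = begin
    (A · 𝟙ᴹ a) z
      ≡⟨ A·-reindex (𝟙ᴹ a) z ⟩
    Σℚ n (λ v → indℚ (χS v) ℚ.* indℚ (M.χ (z - v - a)))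
      ≡⟨ Σℚ-cong (λ v → cong (λ u → indℚ (χS v) ℚ.* indℚ (M.χ u)) (sub-sub-comm z v a)) ⟩
    Σℚ n (λ v → indℚ (χS v) ℚ.* indℚ (M.χ (y - v)))
      ≡⟨ Σℚ-cong (λ v → indℚ-*-congˡ (χS v) (χS y) _ (χS-shift v)) ⟩
    Σℚ n (λ v → indℚ (χS y) ℚ.* indℚ (M.χ (y - v)))
      ≡⟨ Σℚ-*ˡ (indℚ (χS y)) (λ v → indℚ (M.χ (y - v))) ⟩
    indℚ (χS y) ℚ.* Σℚ n (λ v → indℚ (M.χ (y - v)))
      ≡⟨ cong (indℚ (χS y) ℚ.*_) (sym (Σℚ-involution (indℚ ∘ M.χ) (λ v → y - v) (sub-sub-cancel y))) ⟩
    indℚ (χS y) ℚ.* Σℚ n (λ v → indℚ (M.χ v))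
      ≡⟨ cong (indℚ (χS y) ℚ.*_) (Σℚ-indℚ M.χ) ⟩
    indℚ (χS y) ℚ.* ℕ→ℚ |M| ∎
    where
    open ≡-Reasoning
    y = z - a
    χS-shift : ∀ v → M.χ (y - v) ≡ true → χS v ≡ χS y
    χS-shift v y∼v = χS-stable (M.∼-sym (does-true (M.dec _) y∼v))

  A·δ : ∀ a z → (A · δ a) z ≡ indℚ (χS (z - a))
  A·δ a z = begin
    (A · δ a) z
      ≡⟨ Σℚ-δ _ a off ⟩
    A z a ℚ.* indℚ (does (a Fin.≟ a))
      ≡⟨ cong (λ b → A z a ℚ.* indℚ b) (dec-true (a Fin.≟ a) refl) ⟩
    A z a ℚ.* 1ℚ
      ≡⟨ ℚₚ.*-identityʳ (A z a) ⟩
    A z a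
      ≡⟨ A-entry z a ⟩
    indℚ (χS (z - a)) ∎
    where
    open ≡-Reasoning
    off : ∀ v → v ≢ a → A z v ℚ.* δ a v ≡ 0ℚ
    off v v≢a = trans (cong (λ b → A z v ℚ.* indℚ b) (dec-false (v Fin.≟ a) v≢a)) (ℚₚ.*-zeroʳ (A z v))

  𝟙ᴹ-difference-eigen : ∀ {a b} → I (b - a) →
    InEigenspace A (ℚ.- ℕ→ℚ |M|) (λ z → 𝟙ᴹ a z ℚ.- 𝟙ᴹ b z)
  𝟙ᴹ-difference-eigen {a} {b} b∼a z = begin
    (A · (λ v → 𝟙ᴹ a v ℚ.- 𝟙ᴹ b v)) z
      ≡⟨ ·-sub A (𝟙ᴹ a) (𝟙ᴹ b) z ⟩
    (A · 𝟙ᴹ a) z ℚ.- (A · 𝟙ᴹ b) z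
      ≡⟨ cong₂ ℚ._-_ (A·𝟙ᴹ a z) (A·𝟙ᴹ b z) ⟩
    indℚ (χS (z - a)) ℚ.* μ ℚ.- indℚ (χS (z - b)) ℚ.* μ
      ≡⟨ cong₂ (λ p q → p ℚ.* μ ℚ.- q ℚ.* μ) (indℚ-χS (z - a)) (indℚ-χS (z - b)) ⟩
    (iₐ ℚ.- mₐ) ℚ.* μ ℚ.- (indℚ (I.χ (z - b)) ℚ.- m_b) ℚ.* μ
      ≡⟨ cong (λ p → (iₐ ℚ.- mₐ) ℚ.* μ ℚ.- (indℚ p ℚ.- m_b) ℚ.* μ) (sym same-I-coset) ⟩
    (iₐ ℚ.- mₐ) ℚ.* μ ℚ.- (iₐ ℚ.- m_b) ℚ.* μ
      ≡⟨ solve 4 (λ i p q m → (i :- p) :* m :- (i :- q) :* m := (:- m) :* (p :- q)) refl iₐ mₐ m_b μ ⟩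
    ℚ.- μ ℚ.* (𝟙ᴹ a z ℚ.- 𝟙ᴹ b z) ∎
    where
    open ≡-Reasoning
    μ = ℕ→ℚ |M|
    iₐ = indℚ (I.χ (z - a))
    mₐ = indℚ (M.χ (z - a))
    m_b = indℚ (M.χ (z - b))
    same-I-coset : I.χ (z - a) ≡ I.χ (z - b)
    same-I-coset = I.χ-∼ (subst I (sym (sub-sub-sub z a b)) b∼a)

  δ-difference-eigen : ∀ {a b} → M (b - a) → InEigenspace A 0ℚ (λ z → δ a z ℚ.- δ b z)
  δ-difference-eigen {a} {b} b∼a z = begin
    (A · (λ v → δ a v ℚ.- δ b v)) z
      ≡⟨ ·-sub A (δ a) (δ b) z ⟩
    (A · δ a) z ℚ.- (A · δ b) z
      ≡⟨ cong₂ ℚ._-_ (A·δ a z) (A·δ b z) ⟩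
    indℚ (χS (z - a)) ℚ.- indℚ (χS (z - b))
      ≡⟨ cong (λ p → indℚ p ℚ.- indℚ (χS (z - b))) (χS-stable (subst M (sym (sub-sub-sub z a b)) b∼a)) ⟩
    indℚ (χS (z - b)) ℚ.- indℚ (χS (z - b))
      ≡⟨ ℚₚ.+-inverseʳ (indℚ (χS (z - b))) ⟩
    0ℚ
      ≡⟨ sym (ℚₚ.*-zeroˡ (δ a z ℚ.- δ b z)) ⟩
    0ℚ ℚ.* (δ a z ℚ.- δ b z) ∎
    where open ≡-Reasoning

  m₁ : ℕ
  m₁ = countᵇ I.isRep

  E₁ : IndepEigenvectors A (ℕ→ℚ |S|) m₁
  E₁ = (λ j → 𝟙ᴵ (w j)) , (λ j → A·𝟙ᴵ (w j)) , pivots⇒linIndep _ w on off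
    where
    w = enumᵇ I.isRep
    on : ∀ j → 𝟙ᴵ (w j) (w j) ≡ 1ℚ
    on j = cong indℚ (dec-true (I.dec _) (I.∼-refl (w j)))
    off : ∀ i j → j ≢ i → 𝟙ᴵ (w j) (w i) ≡ 0ℚ
    off i j j≢i = cong indℚ (dec-false (I.dec _) λ wᵢ∼wⱼ → j≢i (sym (enumᵇ-injective I.isRep i j
      (I.isRep-∼⇒≡ (enumᵇ-true I.isRep i) (enumᵇ-true I.isRep j) wᵢ∼wⱼ))))

  isRepᴹ-notᴵ : Fin n → Bool
  isRepᴹ-notᴵ w = M.isRep w ∧ not (I.isRep w)

  m₂ : ℕ
  m₂ = countᵇ isRepᴹ-notᴵ

  E₂ : IndepEigenvectors A (ℚ.- ℕ→ℚ |M|) m₂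
  E₂ = f , eigen , pivots⇒linIndep f w on off
    where
    w = enumᵇ isRepᴹ-notᴵ
    r = λ j → I.rep (w j)
    f : Fin m₂ → Vector n
    f j z = 𝟙ᴹ (w j) z ℚ.- 𝟙ᴹ (r j) z

    eigen : ∀ j → InEigenspace A (ℚ.- ℕ→ℚ |M|) (f j)
    eigen j = 𝟙ᴹ-difference-eigen (I.∼-sym (I.rep-∼ (w j)))

    M-rep : ∀ j → M.isRep (w j) ≡ true
    M-rep j = proj₁ (∧-not-true _ _ (enumᵇ-true isRepᴹ-notᴵ j))

    -- w i and r j are both M-representatives, so w i ∼ r j would make w i an I-representative.
    ≁r : ∀ i j → ¬ M (w i - r j)
    ≁r i j wᵢ∼rⱼ = true≢false (begin
      true            ≡⟨ sym I-rep ⟩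
      I.isRep (r j)   ≡⟨ cong I.isRep (sym wᵢ≡rⱼ) ⟩
      I.isRep (w i)   ≡⟨ proj₂ (∧-not-true _ _ (enumᵇ-true isRepᴹ-notᴵ i)) ⟩
      false           ∎)
      where
      open ≡-Reasoning
      I-rep = I.isRep-rep (w j)
      wᵢ≡rⱼ = M.isRep-∼⇒≡ (M-rep i) (isRep-⊆ M-sub I-sub M⊆I (r j) I-rep) wᵢ∼rⱼ

    on : ∀ j → f j (w j) ≡ 1ℚ
    on j = cong₂ (λ a b → indℚ a ℚ.- indℚ b)
      (dec-true (M.dec _) (M.∼-refl (w j))) (dec-false (M.dec _) (≁r j j))

    off : ∀ i j → j ≢ i → f j (w i) ≡ 0ℚ
    off i j j≢i = cong₂ (λ a b → indℚ a ℚ.- indℚ b)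
      (dec-false (M.dec _) λ wᵢ∼wⱼ →
        j≢i (sym (enumᵇ-injective isRepᴹ-notᴵ i j (M.isRep-∼⇒≡ (M-rep i) (M-rep j) wᵢ∼wⱼ))))
      (dec-false (M.dec _) (≁r i j))

  notRepᴹ : Fin n → Bool
  notRepᴹ w = not (M.isRep w)

  m₃ : ℕ
  m₃ = countᵇ notRepᴹ

  E₃ : IndepEigenvectors A 0ℚ m₃
  E₃ = f , eigen , pivots⇒linIndep f w on off
    where
    w = enumᵇ notRepᴹ
    r = λ j → M.rep (w j)
    f : Fin m₃ → Vector n
    f j z = δ (w j) z ℚ.- δ (r j) z

    eigen : ∀ j → InEigenspace A 0ℚ (f j)
    eigen j = δ-difference-eigen (M.∼-sym (M.rep-∼ (w j)))

    ≢r : ∀ i j → w i ≢ r j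
    ≢r i j wᵢ≡rⱼ = true≢false (begin
      true            ≡⟨ sym (M.isRep-rep (w j)) ⟩
      M.isRep (r j)   ≡⟨ cong M.isRep (sym wᵢ≡rⱼ) ⟩
      M.isRep (w i)   ≡⟨ not-true _ (enumᵇ-true notRepᴹ i) ⟩
      false           ∎)
      where open ≡-Reasoning

    on : ∀ j → f j (w j) ≡ 1ℚ
    on j = cong₂ (λ a b → indℚ a ℚ.- indℚ b)
      (dec-true (w j Fin.≟ w j) refl) (dec-false (w j Fin.≟ r j) (≢r j j))

    off : ∀ i j → j ≢ i → f j (w i) ≡ 0ℚ
    off i j j≢i = cong₂ (λ a b → indℚ a ℚ.- indℚ b)
      (dec-false (w i Fin.≟ w j) λ wᵢ≡wⱼ → j≢i (sym (enumᵇ-injective notRepᴹ i j wᵢ≡wⱼ)))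
      (dec-false (w i Fin.≟ r j) (≢r i j))

  m₁+m₂≡#M-reps : m₁ ℕ.+ m₂ ≡ countᵇ M.isRep
  m₁+m₂≡#M-reps = trans (ℕₚ.+-comm m₁ m₂) (countᵇ-+ isRepᴹ-notᴵ I.isRep M.isRep λ w →
    ind-∧-not (M.isRep w) (I.isRep w) (isRep-⊆ M-sub I-sub M⊆I w))

  #M-reps+m₃≡n : countᵇ M.isRep ℕ.+ m₃ ≡ n
  #M-reps+m₃≡n = trans (ℕₚ.+-comm _ m₃) (trans (countᵇ-+ notRepᴹ M.isRep (λ _ → true) λ w →
    ind-∧-not true (M.isRep w) (λ _ → refl)) (countᵇ-true n))

  |S|-suc : ∃ λ k → |S| ≡ ℕ.suc k
  |S|-suc = countᵇ-nonEmpty χS (proj₁ S-nonempty) (dec-true (S? _) (proj₂ S-nonempty))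

  |M|-suc : ∃ λ k → |M| ≡ ℕ.suc k
  |M|-suc = countᵇ-nonEmpty M.χ 0# (dec-true (M.dec 0#) M.0∈)

  |S|≢-|M| : ℕ→ℚ |S| ≢ ℚ.- ℕ→ℚ |M|
  |S|≢-|M| = subst (λ s → ℕ→ℚ s ≢ ℚ.- ℕ→ℚ |M|) (sym (proj₂ |S|-suc)) (ℕ→ℚ-suc≢-ℕ→ℚ (proj₁ |S|-suc) |M|)

  |S|≢0 : ℕ→ℚ |S| ≢ 0ℚ
  |S|≢0 = subst (λ s → ℕ→ℚ s ≢ 0ℚ) (sym (proj₂ |S|-suc)) (ℕ→ℚ-suc≢0 (proj₁ |S|-suc))

  -|M|≢0 : ℚ.- ℕ→ℚ |M| ≢ 0ℚ
  -|M|≢0 = subst (λ m → ℚ.- ℕ→ℚ m ≢ 0ℚ) (sym (proj₂ |M|-suc)) (-ℕ→ℚ-suc≢0 (proj₁ |M|-suc))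

  multiplicities : HasEigMult A (ℕ→ℚ |S|) m₁ × HasEigMult A (ℚ.- ℕ→ℚ |M|) m₂ × HasEigMult A 0ℚ m₃
  multiplicities = hasEigMult₃ A |S|≢-|M| |S|≢0 -|M|≢0
    (trans (cong (ℕ._+ m₃) m₁+m₂≡#M-reps) #M-reps+m₃≡n) E₁ E₂ E₃

  m₂-equation : m₂ ℕ.* (|I| ℕ.* |M|) ≡ n ℕ.* |S|
  m₂-equation = difference-of-quotients m₁ m₂ |I| |M| |S| n I.lagrange
    (trans (cong (ℕ._* |M|) m₁+m₂≡#M-reps) M.lagrange) |S|+|M|≡|I|

  m₃-equation : m₃ ℕ.* |M| ≡ n ℕ.* (|M| ℕ.∸ 1)
  m₃-equation with |M| | |M|-suc | M.lagrange
  ... | _ | k , refl | lagrangeᴹ = complement-of-quotient (countᵇ M.isRep) m₃ k n #M-reps+m₃≡n lagrangeᴹ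

  spectrum :
      (∃ λ m₁ → m₁ ℕ.* count I.dec ≡ n × HasEigMult A (ℕ→ℚ (count S?)) m₁)
    × (∃ λ m₂ → m₂ ℕ.* (count I.dec ℕ.* count M.dec) ≡ n ℕ.* count S?
                × HasEigMult A (ℚ.- ℕ→ℚ (count M.dec)) m₂)
    × (∃ λ m₃ → m₃ ℕ.* count M.dec ≡ n ℕ.* (count M.dec ℕ.∸ 1) × HasEigMult A 0ℚ m₃)
  spectrum rewrite count≡countᵇ S? | count≡countᵇ I.dec | count≡countᵇ M.dec =
    (m₁ , I.lagrange , proj₁ multiplicities) ,
    (m₂ , m₂-equation , proj₁ (proj₂ multiplicities)) ,
    (m₃ , m₃-equation , proj₂ (proj₂ multiplicities))

module LocalRing {n} (R : FinCommRing n) (local : FinCommRing.IsLocal R)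
                 (x : Fin n) (x≢0 : x ≢ FinCommRing.0# R) where

  open import Data.Empty using (⊥)
  open import Data.Unit using (⊤; tt)
  open import Data.Sum using (inj₁; inj₂)
  open import Function.Base using (case_of_)
  open import Function.Bundles using (mk⇔)
  open import Relation.Nullary using (yes; no)
  open import Relation.Nullary.Decidable using (decidable-stable)
  open import Relation.Binary.PropositionalEquality
  open import Algebra.Bundles using (CommutativeRing)
  open FinCommRing R

  private
    ring : CommutativeRing 0ℓ 0ℓ
    ring = record { isCommutativeRing = isCommutativeRing }
    open CommutativeRing ring using (distribˡ; zeroˡ; zeroʳ; *-assoc; *-identityʳ; -‿inverseʳ; +-isAbelianGroup)
    open import Algebra.Properties.Ring (CommutativeRing.ring ring) using (-‿distribˡ-*; -‿distribʳ-*)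
    open ≡-Reasoning

  +-group : FinAbelianGroup n
  +-group = record { isAbelianGroup = +-isAbelianGroup }

  open FinAbelianGroup +-group using (+-sub-cancel)

  nonUnit-0 : ¬ IsUnit 0#
  nonUnit-0 (s , 0s≡1) = proj₁ local (trans (sym (zeroˡ s)) 0s≡1)

  nonUnit-+ : ∀ {r s} → ¬ IsUnit r → ¬ IsUnit s → ¬ IsUnit (r + s)
  nonUnit-+ {r} {s} r∉R* s∉R* r+s∈R* with proj₂ local r s r+s∈R*
  ... | inj₁ r∈R* = r∉R* r∈R*
  ... | inj₂ s∈R* = s∉R* s∈R*

  nonUnit-neg : ∀ {r} → ¬ IsUnit r → ¬ IsUnit (- r)
  nonUnit-neg {r} r∉R* (s , [-r]s≡1) =
    r∉R* (- s , trans (sym (-‿distribʳ-* r s)) (trans (-‿distribˡ-* r s) [-r]s≡1))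

  x*-cancel-unit : ∀ {r u} → IsUnit (u - r) → x * r ≡ x * u → ⊥
  x*-cancel-unit {r} {u} (s , [u-r]s≡1) xr≡xu = x≢0 (begin
    x                      ≡⟨ sym (*-identityʳ x) ⟩
    x * 1#                 ≡⟨ cong (x *_) (sym [u-r]s≡1) ⟩
    x * ((u - r) * s)      ≡⟨ sym (*-assoc x (u - r) s) ⟩
    x * (u - r) * s        ≡⟨ cong (_* s) x[u-r]≡0 ⟩
    0# * s                 ≡⟨ zeroˡ s ⟩
    0#                     ∎)
    where
    x[u-r]≡0 : x * (u - r) ≡ 0#
    x[u-r]≡0 = begin
      x * (u + - r)        ≡⟨ distribˡ x u (- r) ⟩
      x * u + x * - r      ≡⟨ cong (x * u +_) (sym (-‿distribʳ-* x r)) ⟩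
      x * u + - (x * r)    ≡⟨ cong (λ t → x * u + - t) xr≡xu ⟩
      x * u + - (x * u)    ≡⟨ -‿inverseʳ (x * u) ⟩
      0#                   ∎

  x·-subgroup : ∀ {J H : Pred (Fin n) 0ℓ} →
    J 0# → (∀ {r s} → J r → J s → J (r + s)) → (∀ {r} → J r → J (- r)) →
    Decidable H → (∀ {y} → H y ⇔ (∃ λ r → J r × y ≡ x * r)) → IsDecSubgroup +-group H
  x·-subgroup J-0 J-+ J-neg H? H⇔ = record
    { dec        = H?
    ; 0∈         = from H⇔ (0# , J-0 , sym (zeroʳ x))
    ; +-closed   = λ a∈H b∈H → let (r , Jr , a≡xr) = to H⇔ a∈H ; (s , Js , b≡xs) = to H⇔ b∈H in
                   from H⇔ (r + s , J-+ Jr Js , trans (cong₂ _+_ a≡xr b≡xs) (sym (distribˡ x r s)))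
    ; neg-closed = λ a∈H → let (r , Jr , a≡xr) = to H⇔ a∈H in
                   from H⇔ (- r , J-neg Jr , trans (cong -_ a≡xr) (-‿distribʳ-* x r))
    }
    where open Equivalence

  I-sub : IsDecSubgroup +-group (InI x)
  I-sub = x·-subgroup {J = λ _ → ⊤} tt (λ _ _ → tt) (λ _ → tt) (inI? x)
    (mk⇔ (λ (r , y≡xr) → r , tt , y≡xr) (λ (r , _ , y≡xr) → r , y≡xr))

  -- This is where x ≢ 0 enters: x r with r a non-unit never lies in xR*.
  InM⇔ : ∀ {y} → InM x y ⇔ (∃ λ r → ¬ IsUnit r × y ≡ x * r)
  InM⇔ {y} = mk⇔ (λ ((r , y≡xr) , y∉xR*) → r , (λ r∈R* → y∉xR* (r , r∈R* , y≡xr)) , y≡xr) from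
    where
    from : (∃ λ r → ¬ IsUnit r × y ≡ x * r) → InM x y
    from (r , r∉R* , y≡xr) = (r , y≡xr) , λ (u , u∈R* , y≡xu) →
      case proj₂ local r (u - r) (subst IsUnit (sym (+-sub-cancel u r)) u∈R*) of λ where
        (inj₁ r∈R*)   → r∉R* r∈R*
        (inj₂ u-r∈R*) → x*-cancel-unit u-r∈R* (trans (sym y≡xr) y≡xu)

  M-sub : IsDecSubgroup +-group (InM x)
  M-sub = x·-subgroup nonUnit-0 nonUnit-+ nonUnit-neg (inM? x) InM⇔

  xR*⇔I∖M : ∀ {y} → InxR* x y ⇔ (InI x y × ¬ InM x y)
  xR*⇔I∖M {y} = mk⇔
    (λ y∈xR*@(r , _ , y≡xr) → (r , y≡xr) , λ (_ , y∉xR*) → y∉xR* y∈xR*)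
    (λ (y∈I , y∉M) → decidable-stable (inxR*? x y) (λ y∉xR* → y∉M (y∈I , y∉xR*)))

  x∈xR* : InxR* x x
  x∈xR* = 1# , (1# , *-identityʳ 1#) , sym (*-identityʳ x)

  cayleyAdj-entry : ∀ u v → cayleyAdj R x u v ≡ cayleyMatrix +-group (inxR*? x) u v
  cayleyAdj-entry u v with inxR*? x (u - v)
  ... | yes _ = refl
  ... | no _  = refl

open import Data.Nat using (ℕ; _*_; _∸_)
open import Data.Rational using (0ℚ; -_)

lemma3p5 : ∀ (n : ℕ) (R : FinCommRing n) → FinCommRing.IsLocal R →
    (x : Fin n) → x ≢ FinCommRing.0# R →
    let A  = cayleyAdj R x
        xR = count (FinCommRing.inxR*? R x)
        I  = count (FinCommRing.inI? R x)
        M  = count (FinCommRing.inM? R x)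
    in (∃ λ m₁ → m₁ * I ≡ n × HasEigMult A (ℕ→ℚ xR) m₁)
       × (∃ λ m₂ → m₂ * (I * M) ≡ n * xR × HasEigMult A (- ℕ→ℚ M) m₂)
       × (∃ λ m₃ → m₃ * M ≡ n * (M ∸ 1) × HasEigMult A 0ℚ m₃)
lemma3p5 n R local x x≢0 = spectrum
  where
  open FinCommRing R using (inxR*?)
  open LocalRing R local x x≢0
  open CayleyGraphOfSubgroupDifference +-group I-sub M-sub proj₁ (inxR*? x) xR*⇔I∖M (x , x∈xR*)
         (cayleyAdj R x) cayleyAdj-entry
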